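{- Let $\mathbb{F}$ be a field. Suppose there are constants $a,b$ such that, for all sufficiently large $n$, the tensor $\langle n,n,n\rangle$ over $\mathbb{F}$ has rank at most $a\cdot n^2\cdot(\log n)^b$. Then $N\times N$ matrices over $\mathbb{F}$ can be multiplied using $N^2\cdot 2^{O((\log\log N)^2)}$ arithmetic operations.
   Context: $\langle n,n,n\rangle=\sum_{i,j,k\in[n]}a_{ij}b_{jk}c_{ki}$ is the matrix multiplication tensor; rank is the minimum number of products of three linear forms summing to the tensor. Arithmetic operations are field operations $+,-,\times,\div$ in the arithmetic circuit model. -}

module Defs where

open import Level using (Level; _⊔_) renaming (suc to lsuc)
open import Data.Nat using (ℕ; _≤_)
import Data.Nat as ℕ
open import Data.Fin using (Fin; _≟_)
import Data.Fin as Fin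
open import Data.Bool using (Bool; true; false; if_then_else_)
open import Data.Product using (Σ; ∃; ∃-syntax; _×_; _,_)
open import Data.Unit.Polymorphic using (⊤)
open import Data.Vec using (Vec; []; _∷_; lookup)
open import Relation.Nullary using (¬_; does)
open import Algebra.Bundles using (CommutativeRing)
open import Algebra.Morphism.Structures using (IsRingHomomorphism)

record Field (c ℓ : Level) : Set (lsuc (c ⊔ ℓ)) where
  field
    commutativeRing : CommutativeRing c ℓ
  open CommutativeRing commutativeRing public
  field
    0≉1      : ¬ (0# ≈ 1#)
    inv      : (x : Carrier) → ¬ (x ≈ 0#) → Carrier
    inverseˡ : (x : Carrier) (p : ¬ (x ≈ 0#)) → inv x p * x ≈ 1#

module _ {c ℓ : Level} (F : Field c ℓ) where
  open Field F using (Carrier; _≈_; _+_; _*_; 0#; 1#)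

  sumF : (r : ℕ) → (Fin r → Carrier) → Carrier
  sumF ℕ.zero    f = 0#
  sumF (ℕ.suc r) f = f Fin.zero + sumF r (λ t → f (Fin.suc t))

  δ : {n : ℕ} → Fin n → Fin n → Carrier
  δ i j = if does (i ≟ j) then 1# else 0#

-- The matrix multiplication tensor <n,n,n> = Σ_{i,j,k} a_ij b_jk c_ki,
-- as its coefficient array: the coefficient of a_{(i,j)} b_{(j',k)} c_{(k',i')}.

  Idx : ℕ → Set
  Idx n = Fin n × Fin n

  MMTensor : (n : ℕ) → Idx n → Idx n → Idx n → Carrier
  MMTensor n (i , j) (j' , k) (k' , i') = δ j j' * (δ k k' * δ i i')

  RankAtMost : (n r : ℕ) → Set (c ⊔ ℓ)
  RankAtMost n r =
    Σ (Fin r → Idx n → Carrier) λ u →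
    Σ (Fin r → Idx n → Carrier) λ v →
    Σ (Fin r → Idx n → Carrier) λ w →
    ∀ x y z → MMTensor n x y z ≈ sumF r (λ t → u t x * (v t y * w t z))

-- Each gate performs one field operation
-- + , - , × , ÷ ; its operands are input variables, earlier gates
-- (de Bruijn: zero = most recent gate) or constants from F.
-- The number of arithmetic operations is the number of gates.

data Op : Set where
  plus minus times divide : Op

module _ {c ℓ : Level} (F : Field c ℓ) where
  open Field F using (Carrier)

  data Operand (I : Set) (k : ℕ) : Set c where
    input : I → Operand I k
    gate  : Fin k → Operand I k
    const : Carrier → Operand I k

  data Circuit (I : Set) : ℕ → Set c where
    []  : Circuit I 0
    _▷_ : {k : ℕ} → Circuit I k → Op × Operand I k × Operand I k → Circuit I (ℕ.suc k)

module Eval {c ℓ : Level} (F : Field c ℓ) (K : Field c ℓ)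
            (φ : Field.Carrier F → Field.Carrier K)
            {I : Set} (ρ : I → Field.Carrier K) where
  open Field K using (Carrier; _≈_; _+_; _-_; _*_; 0#; inv)

  ⟦_⟧ : {k : ℕ} → Operand F I k → Vec Carrier k → Carrier
  ⟦ input i ⟧ vs = ρ i
  ⟦ gate g  ⟧ vs = lookup vs g
  ⟦ const a ⟧ vs = φ a

  Defined : {k : ℕ} → Op × Operand F I k × Operand F I k → Vec Carrier k → Set ℓ
  Defined (divide , x , y) vs = ¬ (⟦ y ⟧ vs ≈ 0#)
  Defined (plus   , x , y) vs = ⊤
  Defined (minus  , x , y) vs = ⊤
  Defined (times  , x , y) vs = ⊤

  value : {k : ℕ} (g : Op × Operand F I k × Operand F I k) (vs : Vec Carrier k) →
          Defined g vs → Carrier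
  value (plus   , x , y) vs d = ⟦ x ⟧ vs + ⟦ y ⟧ vs
  value (minus  , x , y) vs d = ⟦ x ⟧ vs - ⟦ y ⟧ vs
  value (times  , x , y) vs d = ⟦ x ⟧ vs * ⟦ y ⟧ vs
  value (divide , x , y) vs d = ⟦ x ⟧ vs * inv (⟦ y ⟧ vs) d

  data Runs : {k : ℕ} → Circuit F I k → Vec Carrier k → Set (c ⊔ ℓ) where
    []   : Runs [] []
    step : {k : ℕ} {P : Circuit F I k} {vs : Vec Carrier k}
           (g : Op × Operand F I k × Operand F I k) →
           Runs P vs → (d : Defined g vs) → Runs (P ▷ g) (value g vs d ∷ vs)

-- Matrix multiplication circuits.  Inputs: (false , i , j) is the entry
-- A_ij, (true , i , j) is the entry B_ij.  Outputs: one operand per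
-- entry of the product.
--
-- The circuit computes A·B (as rational functions over F, the standard
-- semantics of circuits with division) iff
--   (1) it is defined at some point of some extension field of F, and
--   (2) whenever it is defined at a point of an extension field K of F,
--       its outputs equal the entries of the matrix product there.

MMIn : ℕ → Set
MMIn N = Bool × Fin N × Fin N

module _ {c ℓ : Level} (F : Field c ℓ) where

  ComputesMM : (N k : ℕ) → Circuit F (MMIn N) k →
               (Fin N → Fin N → Operand F (MMIn N) k) → Set (lsuc (c ⊔ ℓ))
  ComputesMM N k P out =
    (Σ (Field c ℓ) λ K →
     Σ (Field.Carrier F → Field.Carrier K) λ φ →
     IsRingHomomorphism (Field.rawRing F) (Field.rawRing K) φ ×
     Σ (MMIn N → Field.Carrier K) λ ρ →
     Σ (Vec (Field.Carrier K) k) λ vs → Eval.Runs F K φ ρ P vs)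
    ×
    ((K : Field c ℓ) (φ : Field.Carrier F → Field.Carrier K) →
     IsRingHomomorphism (Field.rawRing F) (Field.rawRing K) φ →
     (ρ : MMIn N → Field.Carrier K) (vs : Vec (Field.Carrier K) k) →
     Eval.Runs F K φ ρ P vs →
     (i j : Fin N) →
     Field._≈_ K (Eval.⟦_⟧ F K φ ρ (out i j) vs)
                 (sumF K N (λ l → Field._*_ K (ρ (false , i , l)) (ρ (true , l , j)))))

  MMCost≤ : (N s : ℕ) → Set (lsuc (c ⊔ ℓ))
  MMCost≤ N s =
    Σ ℕ λ k → k ≤ s ×
    Σ (Circuit F (MMIn N) k) λ P →
    Σ (Fin N → Fin N → Operand F (MMIn N) k) λ out → ComputesMM N k P out

-- A bilinear algorithm of rank g·n² for ⟨n,n,n⟩ multiplies matrices of size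
-- N = n·m, m = n·t, with g·n² products of m × m blocks.  Its linear forms in
-- the blocks of either factor, and the recombination of the products into the
-- output blocks, are again matrix products: one n² × n² product for every
-- γ < g and every offset in t × t.  Hence, if smaller sizes M cost B·M²,
--   T(N) ≤ 3·g·t²·B·n⁴ + g·n²·B·(n·t)² + g·N² ≤ 5·g·B·N².
-- For N = 2^e and n = 2^⌊e/3⌋ the exponent shrinks by a factor 2/3 per level,
-- so O(log e) levels suffice, each costing a factor 5·g = 2^O(log e) by the
-- rank hypothesis; in total N²·2^O((log log N)²).

{-# OPTIONS --safe #-}
module Submission where

open import Defs
open import Level using (Level; _⊔_) renaming (suc to lsuc; zero to lzero)
import Data.Nat as ℕ
open ℕ using (ℕ; zero; suc)
import Data.Nat.Properties as ℕₚ
open import Data.Fin using (Fin; _≟_; _↑ˡ_; _↑ʳ_; splitAt; combine; remQuot)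
import Data.Fin as Fin
import Data.Fin.Properties as Finₚ
open import Data.Bool using (Bool; true; false)
open import Data.Product using (Σ; _×_; _,_; proj₁; proj₂)
open import Data.Sum using (_⊎_; inj₁; inj₂; [_,_])
open import Data.Unit using (⊤; tt)
open import Data.Vec using (Vec; []; _∷_; lookup)
open import Function using (_∘_; id)
open import Relation.Binary.PropositionalEquality as ≡ using (_≡_; _≢_)
open import Relation.Nullary.Decidable using (dec-true; dec-false)
open import Data.Nat.Logarithm using (⌈log₂_⌉; ⌈log₂⌉-mono-≤; ⌈log₂2^n⌉≡n)
open import Algebra.Morphism.Structures using (IsRingHomomorphism)
import Algebra.Morphism.Construct.Identity as Identity
import Algebra.Solver.CommutativeMonoid as CommutativeMonoidSolver
open import Data.Nat.Tactic.RingSolver using (solve-∀)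

module Sums {c ℓ : Level} (K : Field c ℓ) where
  open Field K
  open import Algebra.Properties.Semiring.Sum semiring public
  open import Relation.Binary.Reasoning.Setoid setoid

  sumF≡sum : ∀ n (f : Fin n → Carrier) → sumF K n f ≡ sum f
  sumF≡sum zero    f = ≡.refl
  sumF≡sum (suc n) f = ≡.cong (f Fin.zero +_) (sumF≡sum n (f ∘ Fin.suc))

  matrixProduct : ∀ N → (MMIn N → Carrier) → Fin N × Fin N → Carrier
  matrixProduct N vals ij = ∑[ l < N ] (vals (false , proj₁ ij , l) * vals (true , l , proj₂ ij))

  sum-zero : ∀ {n} {f : Fin n → Carrier} → (∀ i → f i ≈ 0#) → sum f ≈ 0#
  sum-zero {n} f≈0 = trans (sum-cong-≋ f≈0) (sum-replicate-zero n)

  sum-↑ : ∀ m {d} (f : Fin (m ℕ.+ d) → Carrier) →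
          sum f ≈ sum (f ∘ (_↑ˡ d)) + sum (f ∘ (m ↑ʳ_))
  sum-↑ zero    f = sym (+-identityˡ _)
  sum-↑ (suc m) f = trans (+-congˡ (sum-↑ m (f ∘ Fin.suc))) (sym (+-assoc _ _ _))

  sum-combine : ∀ m {n} (f : Fin (m ℕ.* n) → Carrier) →
                sum f ≈ ∑[ i < m ] ∑[ j < n ] f (combine i j)
  sum-combine zero        f = refl
  sum-combine (suc m) {n} f = trans (sum-↑ n f) (+-congˡ (sum-combine m (f ∘ (n ↑ʳ_))))

  sum-remQuot : ∀ m {n} (f : Fin m × Fin n → Carrier) →
                ∑[ x < m ℕ.* n ] f (remQuot n x) ≈ ∑[ i < m ] ∑[ j < n ] f (i , j)
  sum-remQuot m {n} f = trans (sum-combine m _)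
    (sum-cong-≋ λ i → sum-cong-≋ λ j → reflexive (≡.cong f (Finₚ.remQuot-combine i j)))

  sum-select : ∀ {n} (f e : Fin n → Carrier) (i₀ : Fin n) →
               e i₀ ≈ 1# → (∀ i → i ≢ i₀ → e i ≈ 0#) → ∑[ i < n ] (f i * e i) ≈ f i₀
  sum-select f e Fin.zero e₀≈1 e≈0 = begin
    f Fin.zero * e Fin.zero + ∑[ i < _ ] (f (Fin.suc i) * e (Fin.suc i))
      ≈⟨ +-cong (*-congˡ e₀≈1) (sum-zero λ i → trans (*-congˡ (e≈0 (Fin.suc i) λ ())) (zeroʳ _)) ⟩
    f Fin.zero * 1# + 0#  ≈⟨ +-identityʳ _ ⟩
    f Fin.zero * 1#       ≈⟨ *-identityʳ _ ⟩
    f Fin.zero            ∎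
  sum-select f e (Fin.suc i₀) e₀≈1 e≈0 = begin
    f Fin.zero * e Fin.zero + ∑[ i < _ ] (f (Fin.suc i) * e (Fin.suc i))
      ≈⟨ +-cong (trans (*-congˡ (e≈0 Fin.zero λ ())) (zeroʳ _))
                (sum-select (f ∘ Fin.suc) (e ∘ Fin.suc) i₀ e₀≈1
                            (λ i i≢i₀ → e≈0 (Fin.suc i) (i≢i₀ ∘ Finₚ.suc-injective))) ⟩
    0# + f (Fin.suc i₀)   ≈⟨ +-identityˡ _ ⟩
    f (Fin.suc i₀)        ∎

module _ {c ℓ : Level} (F : Field c ℓ) where
  open Field F using (0#; 1#)

  δ-diag : ∀ {n} (i : Fin n) → δ F i i ≡ 1#
  δ-diag i rewrite dec-true (i ≟ i) ≡.refl = ≡.refl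

  δ-off : ∀ {n} {i j : Fin n} → i ≢ j → δ F i j ≡ 0#
  δ-off {i = i} {j} i≢j rewrite dec-false (i ≟ j) i≢j = ≡.refl

module Bilinear {c ℓ : Level} (F K : Field c ℓ) (φ : Field.Carrier F → Field.Carrier K)
                (hom : IsRingHomomorphism (Field.rawRing F) (Field.rawRing K) φ) where
  open Field K
  open Sums K
  open IsRingHomomorphism hom using (⟦⟧-cong; +-homo; *-homo; 0#-homo; 1#-homo)
  open import Relation.Binary.Reasoning.Setoid setoid

  φ-sumF : ∀ r (f : Fin r → Field.Carrier F) → φ (sumF F r f) ≈ ∑[ t < r ] φ (f t)
  φ-sumF zero    f = 0#-homo
  φ-sumF (suc r) f = trans (+-homo _ _) (+-congˡ (φ-sumF r (f ∘ Fin.suc)))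

  φδ-diag : ∀ {n} (i : Fin n) → φ (δ F i i) ≈ 1#
  φδ-diag i = trans (reflexive (≡.cong φ (δ-diag F i))) 1#-homo

  φδ-off : ∀ {n} {i j : Fin n} → i ≢ j → φ (δ F i j) ≈ 0#
  φδ-off i≢j = trans (reflexive (≡.cong φ (δ-off F i≢j))) 0#-homo

  sum-δˡ : ∀ {n} (f : Fin n → Carrier) (i₀ : Fin n) → ∑[ i < n ] (f i * φ (δ F i i₀)) ≈ f i₀
  sum-δˡ f i₀ = sum-select f (λ i → φ (δ F i i₀)) i₀ (φδ-diag i₀) (λ i → φδ-off)

  sum-δʳ : ∀ {n} (f : Fin n → Carrier) (i₀ : Fin n) → ∑[ i < n ] (f i * φ (δ F i₀ i)) ≈ f i₀
  sum-δʳ f i₀ = sum-select f (λ i → φ (δ F i₀ i)) i₀ (φδ-diag i₀) (λ i → φδ-off ∘ ≡.≢-sym)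

  module _ {n : ℕ} where
    ∑⁴ : (Fin n → Fin n → Fin n → Fin n → Carrier) → Carrier
    ∑⁴ f = ∑[ i < n ] ∑[ j < n ] ∑[ j′ < n ] ∑[ k < n ] f i j j′ k

    ∑⁴-cong : ∀ {f g : Fin n → Fin n → Fin n → Fin n → Carrier} →
              (∀ i j j′ k → f i j j′ k ≈ g i j j′ k) → ∑⁴ f ≈ ∑⁴ g
    ∑⁴-cong f≈g = sum-cong-≋ λ i → sum-cong-≋ λ j → sum-cong-≋ λ j′ → sum-cong-≋ (f≈g i j j′)

    *-distribˡ-∑⁴ : ∀ x (f : Fin n → Fin n → Fin n → Fin n → Carrier) →
                    x * ∑⁴ f ≈ ∑⁴ (λ i j j′ k → x * f i j j′ k)
    *-distribˡ-∑⁴ x f =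
      trans (*-distribˡ-sum x (λ i → ∑[ j < n ] ∑[ j′ < n ] ∑[ k < n ] f i j j′ k)) (sum-cong-≋ λ i →
      trans (*-distribˡ-sum x (λ j → ∑[ j′ < n ] ∑[ k < n ] f i j j′ k)) (sum-cong-≋ λ j →
      trans (*-distribˡ-sum x (λ j′ → ∑[ k < n ] f i j j′ k)) (sum-cong-≋ λ j′ → *-distribˡ-sum x (f i j j′))))

    ∑-comm-∑⁴ : ∀ {r} (f : Fin r → Fin n → Fin n → Fin n → Fin n → Carrier) →
                ∑[ τ < r ] ∑⁴ (f τ) ≈ ∑⁴ (λ i j j′ k → ∑[ τ < r ] f τ i j j′ k)
    ∑-comm-∑⁴ f =
      trans (∑-comm (λ τ i → ∑[ j < n ] ∑[ j′ < n ] ∑[ k < n ] f τ i j j′ k)) (sum-cong-≋ λ i →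
      trans (∑-comm (λ τ j → ∑[ j′ < n ] ∑[ k < n ] f τ i j j′ k)) (sum-cong-≋ λ j →
      trans (∑-comm (λ τ j′ → ∑[ k < n ] f τ i j j′ k)) (sum-cong-≋ λ j′ → ∑-comm (λ τ → f τ i j j′))))

    sum²-*-sum² : (f g : Fin n → Fin n → Carrier) →
                  (∑[ i < n ] ∑[ j < n ] f i j) * (∑[ j′ < n ] ∑[ k < n ] g j′ k) ≈
                  ∑⁴ (λ i j j′ k → f i j * g j′ k)
    sum²-*-sum² f g =
      trans (*-distribʳ-sum G (λ i → ∑[ j < n ] f i j)) (sum-cong-≋ λ i →
      trans (*-distribʳ-sum G (f i)) (sum-cong-≋ λ j →
      trans (*-distribˡ-sum (f i j) (λ j′ → ∑[ k < n ] g j′ k)) (sum-cong-≋ λ j′ → *-distribˡ-sum (f i j) (g j′))))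
      where G = ∑[ j′ < n ] ∑[ k < n ] g j′ k

  open CommutativeMonoidSolver *-commutativeMonoid using (solve; _⊕_; _⊜_)

  -- The three Kronecker deltas collapse the sums over k, j′ and i in turn.
  ∑⁴-mmTensor : ∀ {n} (i₀ k₀ : Fin n) (a b : Fin n → Fin n → Carrier) →
    ∑⁴ (λ i j j′ k → (a i j * b j′ k) * (φ (δ F j j′) * (φ (δ F k k₀) * φ (δ F i i₀)))) ≈
    ∑[ j < n ] (a i₀ j * b j k₀)
  ∑⁴-mmTensor {n} i₀ k₀ a b = begin
    ∑⁴ (λ i j j′ k → (a i j * b j′ k) * (δᴷ j j′ * (δᴷ k k₀ * δᴷ i i₀)))
      ≈⟨ sum-cong-≋ (λ i → sum-cong-≋ λ j → sum-cong-≋ λ j′ →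
           trans (sum-cong-≋ λ k → pull-k (a i j) (b j′ k) (δᴷ j j′) (δᴷ k k₀) (δᴷ i i₀))
                 (sum-δˡ (λ k → (a i j * b j′ k) * (δᴷ j j′ * δᴷ i i₀)) k₀)) ⟩
    ∑[ i < n ] ∑[ j < n ] ∑[ j′ < n ] ((a i j * b j′ k₀) * (δᴷ j j′ * δᴷ i i₀))
      ≈⟨ sum-cong-≋ (λ i → sum-cong-≋ λ j →
           trans (sum-cong-≋ λ j′ → pull-j′ (a i j) (b j′ k₀) (δᴷ j j′) (δᴷ i i₀))
                 (sum-δʳ (λ j′ → (a i j * b j′ k₀) * δᴷ i i₀) j)) ⟩
    ∑[ i < n ] ∑[ j < n ] ((a i j * b j k₀) * δᴷ i i₀)
      ≈⟨ trans (sum-cong-≋ λ i → sym (*-distribʳ-sum (δᴷ i i₀) (λ j → a i j * b j k₀)))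
               (sum-δˡ (λ i → ∑[ j < n ] (a i j * b j k₀)) i₀) ⟩
    ∑[ j < n ] (a i₀ j * b j k₀) ∎
    where
    δᴷ : ∀ {n} → Fin n → Fin n → Carrier
    δᴷ i j = φ (δ F i j)
    pull-k : ∀ x y p q s → (x * y) * (p * (q * s)) ≈ ((x * y) * (p * s)) * q
    pull-k = solve 5 (λ x y p q s → (x ⊕ y) ⊕ (p ⊕ (q ⊕ s)) ⊜ ((x ⊕ y) ⊕ (p ⊕ s)) ⊕ q) refl
    pull-j′ : ∀ x y p s → (x * y) * (p * s) ≈ ((x * y) * s) * p
    pull-j′ = solve 4 (λ x y p s → (x ⊕ y) ⊕ (p ⊕ s) ⊜ ((x ⊕ y) ⊕ s) ⊕ p) refl

  -- A decomposition of the K-image of ⟨n,n,n⟩, with the third factor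
  -- specialised to the output position (k₀ , i₀), is a bilinear algorithm for
  -- the (i₀ , k₀) entry of a matrix product over K.
  bilinear-algorithm : ∀ {r n} (i₀ k₀ : Fin n) (U V : Fin r → Fin n → Fin n → Carrier) (W : Fin r → Carrier) →
    (∀ i j j′ k → ∑[ τ < r ] (U τ i j * (V τ j′ k * W τ)) ≈ φ (δ F j j′) * (φ (δ F k k₀) * φ (δ F i i₀))) →
    (a b : Fin n → Fin n → Carrier) →
    ∑[ τ < r ] (W τ * ((∑[ i < n ] ∑[ j < n ] (U τ i j * a i j)) * (∑[ j′ < n ] ∑[ k < n ] (V τ j′ k * b j′ k)))) ≈
    ∑[ j < n ] (a i₀ j * b j k₀)
  bilinear-algorithm i₀ k₀ U V W decomposition a b = begin
    ∑[ τ < _ ] (W τ * ((∑[ i < _ ] ∑[ j < _ ] (U τ i j * a i j)) * (∑[ j′ < _ ] ∑[ k < _ ] (V τ j′ k * b j′ k))))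
      ≈⟨ sum-cong-≋ (λ τ → trans (*-congˡ (sum²-*-sum² (λ i j → U τ i j * a i j) (λ j′ k → V τ j′ k * b j′ k)))
                                 (*-distribˡ-∑⁴ (W τ) (λ i j j′ k → (U τ i j * a i j) * (V τ j′ k * b j′ k)))) ⟩
    ∑[ τ < _ ] ∑⁴ (λ i j j′ k → W τ * ((U τ i j * a i j) * (V τ j′ k * b j′ k)))
      ≈⟨ ∑-comm-∑⁴ (λ τ i j j′ k → W τ * ((U τ i j * a i j) * (V τ j′ k * b j′ k))) ⟩
    ∑⁴ (λ i j j′ k → ∑[ τ < _ ] (W τ * ((U τ i j * a i j) * (V τ j′ k * b j′ k))))
      ≈⟨ ∑⁴-cong (λ i j j′ k →
           trans (sum-cong-≋ λ τ → regroup (W τ) (U τ i j) (V τ j′ k) (a i j) (b j′ k))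
                 (trans (sym (*-distribˡ-sum (a i j * b j′ k) (λ τ → U τ i j * (V τ j′ k * W τ))))
                        (*-congˡ (decomposition i j j′ k)))) ⟩
    ∑⁴ (λ i j j′ k → (a i j * b j′ k) * (φ (δ F j j′) * (φ (δ F k k₀) * φ (δ F i i₀))))
      ≈⟨ ∑⁴-mmTensor i₀ k₀ a b ⟩
    ∑[ j < _ ] (a i₀ j * b j k₀) ∎
    where
    regroup : ∀ w u v x y → w * ((u * x) * (v * y)) ≈ (x * y) * (u * (v * w))
    regroup = solve 5 (λ w u v x y → w ⊕ ((u ⊕ x) ⊕ (v ⊕ y)) ⊜ (x ⊕ y) ⊕ (u ⊕ (v ⊕ w))) refl

  block-bilinear-algorithm : ∀ {r n M} (i₀ k₀ : Fin n) (U V : Fin r → Fin n → Fin n → Carrier) (W : Fin r → Carrier) →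
    (∀ i j j′ k → ∑[ τ < r ] (U τ i j * (V τ j′ k * W τ)) ≈ φ (δ F j j′) * (φ (δ F k k₀) * φ (δ F i i₀))) →
    (a b : Fin n → Fin n → Fin M → Carrier) →
    ∑[ τ < r ] (W τ * ∑[ y < M ] ((∑[ i < n ] ∑[ j < n ] (U τ i j * a i j y)) *
                                  (∑[ j′ < n ] ∑[ k < n ] (V τ j′ k * b j′ k y)))) ≈
    ∑[ y < M ] ∑[ j < n ] (a i₀ j y * b j k₀ y)
  block-bilinear-algorithm {r} {n} {M} i₀ k₀ U V W decomposition a b =
    trans (sum-cong-≋ λ τ → *-distribˡ-sum (W τ) (λ y → product τ y))
    (trans (∑-comm (λ τ y → W τ * product τ y))
           (sum-cong-≋ λ y → bilinear-algorithm i₀ k₀ U V W decomposition (λ i j → a i j y) (λ j k → b j k y)))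
    where
    product : Fin r → Fin M → Carrier
    product τ y = (∑[ i < n ] ∑[ j < n ] (U τ i j * a i j y)) * (∑[ j′ < n ] ∑[ k < n ] (V τ j′ k * b j′ k y))

  image-of-decomposition : ∀ {n r} (u v w : Fin r → Idx F n → Field.Carrier F) →
    (∀ x y z → Field._≈_ F (MMTensor F n x y z) (sumF F r λ τ → Field._*_ F (u τ x) (Field._*_ F (v τ y) (w τ z)))) →
    ∀ i₀ k₀ i j j′ k → ∑[ τ < r ] (φ (u τ (i , j)) * (φ (v τ (j′ , k)) * φ (w τ (k₀ , i₀)))) ≈
                       φ (δ F j j′) * (φ (δ F k k₀) * φ (δ F i i₀))
  image-of-decomposition {r = r} u v w decomposition i₀ k₀ i j j′ k = sym (begin
    φ (δ F j j′) * (φ (δ F k k₀) * φ (δ F i i₀))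
      ≈⟨ sym (trans (*-homo _ _) (*-congˡ (*-homo _ _))) ⟩
    φ (MMTensor F _ (i , j) (j′ , k) (k₀ , i₀))
      ≈⟨ ⟦⟧-cong (decomposition (i , j) (j′ , k) (k₀ , i₀)) ⟩
    φ (sumF F r λ τ → Field._*_ F (u τ (i , j)) (Field._*_ F (v τ (j′ , k)) (w τ (k₀ , i₀))))
      ≈⟨ φ-sumF r (λ τ → Field._*_ F (u τ (i , j)) (Field._*_ F (v τ (j′ , k)) (w τ (k₀ , i₀)))) ⟩
    ∑[ τ < r ] φ (Field._*_ F (u τ (i , j)) (Field._*_ F (v τ (j′ , k)) (w τ (k₀ , i₀))))
      ≈⟨ sum-cong-≋ (λ τ → trans (*-homo (u τ (i , j)) _) (*-congˡ (*-homo (v τ (j′ , k)) (w τ (k₀ , i₀))))) ⟩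
    ∑[ τ < r ] (φ (u τ (i , j)) * (φ (v τ (j′ , k)) * φ (w τ (k₀ , i₀)))) ∎)

module Programs {c ℓ : Level} (F : Field c ℓ) where
  open Field F using (Carrier; 0#)
  open import Data.Nat using (_+_; _*_; _≤_)

  data RingOp : Set where
    add mul : RingOp

  toOp : RingOp → Op
  toOp add = plus
  toOp mul = times

  Gate : Set → ℕ → Set c
  Gate J k = RingOp × Operand F J k × Operand F J k

  data Extension (J : Set) (k : ℕ) : ℕ → Set c where
    []  : Extension J k k
    _▷_ : ∀ {k′} → Extension J k k′ → Gate J k′ → Extension J k (suc k′)

  _++_ : ∀ {J k k₁ k₂} → Extension J k k₁ → Extension J k₁ k₂ → Extension J k k₂
  E ++ []      = E
  E ++ (E′ ▷ g) = (E ++ E′) ▷ g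

  toCircuit : ∀ {J k} → Extension J 0 k → Circuit F J k
  toCircuit []                = []
  toCircuit (E ▷ (o , x , y)) = toCircuit E ▷ (toOp o , x , y)

  weakenFin : ∀ {J k k′} → Extension J k k′ → Fin k → Fin k′
  weakenFin []      i = i
  weakenFin (E ▷ g) i = Fin.suc (weakenFin E i)

  weaken : ∀ {J k k′} → Extension J k k′ → Operand F J k → Operand F J k′
  weaken E (input i) = input i
  weaken E (gate g)  = gate (weakenFin E g)
  weaken E (const a) = const a

  record Block (J : Set) (k : ℕ) (X : Set) : Set c where
    constructor block
    field
      {end} : ℕ
      gates : Extension J k end
      out   : X → Operand F J end
  open Block public

  -- Programs are relocatable: given operands for its inputs in any circuit
  -- with k gates, a program appends a block of gates computing its outputs.
  Program : Set → Set → Set (lsuc lzero ⊔ c)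
  Program I X = ∀ {J k} → (I → Operand F J k) → Block J k X

  HasCost : ∀ {I X} → Program I X → ℕ → Set (lsuc lzero ⊔ c)
  HasCost {I} P s = ∀ {J k} (args : I → Operand F J k) → end (P args) ≤ s + k

  data Source (I : Set) : Set c where
    var : I → Source I
    lit : Carrier → Source I

  source : ∀ {I J k} → (I → Operand F J k) → Source I → Operand F J k
  source args (var i) = args i
  source args (lit a) = const a

  relabelIn : ∀ {I I′ X} → (I → Source I′) → Program I X → Program I′ X
  relabelIn h P args = P (source args ∘ h)

  relabelOut : ∀ {I X Y} → (Y → X) → Program I X → Program I Y
  relabelOut h P args = block (gates (P args)) (out (P args) ∘ h)

  seq : ∀ {I X Y} → Program I X → Program (I ⊎ X) Y → Program I Y
  seq P Q args = block (gates B₁ ++ gates B₂) (out B₂)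
    where
    B₁ = P args
    B₂ = Q [ weaken (gates B₁) ∘ args , out B₁ ]

  parallel : ∀ {I X} n → (Fin n → Program I X) → Program I (Fin n × X)
  parallel zero    Ps args = block [] λ ()
  parallel (suc n) Ps args = block (gates B₀ ++ gates Bs) λ where
      (Fin.zero  , x) → weaken (gates Bs) (out B₀ x)
      (Fin.suc a , x) → out Bs (a , x)
    where
    B₀ = Ps Fin.zero args
    Bs = parallel n (Ps ∘ Fin.suc) (weaken (gates B₀) ∘ args)

  mulP : Program Bool ⊤
  mulP args = block ([] ▷ (mul , args false , args true)) λ _ → gate Fin.zero

  sumP : ∀ g → Program (Fin g) ⊤
  sumP zero    args = block [] λ _ → const 0#
  sumP (suc g) args = block (gates B ▷ (add , weaken (gates B) (args Fin.zero) , out B tt)) λ _ → gate Fin.zero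
    where B = sumP g (args ∘ Fin.suc)

  private
    +-exchange : ∀ a b k → b + (a + k) ≡ a + b + k
    +-exchange = solve-∀

  relabelIn-cost : ∀ {I I′ X s} (h : I → Source I′) {P : Program I X} → HasCost P s → HasCost (relabelIn h P) s
  relabelIn-cost h cost args = cost _

  relabelOut-cost : ∀ {I X Y s} (h : Y → X) {P : Program I X} → HasCost P s → HasCost (relabelOut h P) s
  relabelOut-cost h cost = cost

  seq-cost : ∀ {I X Y s₁ s₂} {P : Program I X} {Q : Program (I ⊎ X) Y} →
             HasCost P s₁ → HasCost Q s₂ → HasCost (seq P Q) (s₁ + s₂)
  seq-cost {s₁ = s₁} {s₂} cost₁ cost₂ {k = k} args =
    ℕₚ.≤-trans (cost₂ _) (ℕₚ.≤-trans (ℕₚ.+-monoʳ-≤ s₂ (cost₁ args)) (ℕₚ.≤-reflexive (+-exchange s₁ s₂ k)))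

  parallel-cost : ∀ {I X} n {s} {Ps : Fin n → Program I X} → (∀ a → HasCost (Ps a) s) → HasCost (parallel n Ps) (n * s)
  parallel-cost zero    costs args = ℕₚ.≤-refl
  parallel-cost (suc n) {s} costs {k = k} args =
    ℕₚ.≤-trans (parallel-cost n (costs ∘ Fin.suc) _)
      (ℕₚ.≤-trans (ℕₚ.+-monoʳ-≤ (n * s) (costs Fin.zero args)) (ℕₚ.≤-reflexive (+-exchange s (n * s) k)))

  mulP-cost : HasCost mulP 1
  mulP-cost args = ℕₚ.≤-refl

  sumP-cost : ∀ g → HasCost (sumP g) g
  sumP-cost zero    args = ℕₚ.≤-refl
  sumP-cost (suc g) args = ℕ.s≤s (sumP-cost g _)

module Semantics {c ℓ : Level} (F K : Field c ℓ) (φ : Field.Carrier F → Field.Carrier K) where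
  open Programs F
  open Field K
  open Sums K
  open Eval F K φ using (Runs; step)

  ⟦_⟧ : ∀ {J k} → Operand F J k → (J → Carrier) → Vec Carrier k → Carrier
  ⟦ o ⟧ ρ = Eval.⟦_⟧ F K φ ρ o

  gateValue : ∀ {J k} → (J → Carrier) → Gate J k → Vec Carrier k → Carrier
  gateValue ρ (add , x , y) vs = ⟦ x ⟧ ρ vs + ⟦ y ⟧ ρ vs
  gateValue ρ (mul , x , y) vs = ⟦ x ⟧ ρ vs * ⟦ y ⟧ ρ vs

  run : ∀ {J k k′} → (J → Carrier) → Extension J k k′ → Vec Carrier k → Vec Carrier k′
  run ρ []      vs = vs
  run ρ (E ▷ g) vs = gateValue ρ g (run ρ E vs) ∷ run ρ E vs

  run-++ : ∀ {J k k₁ k₂} (ρ : J → Carrier) (E₁ : Extension J k k₁) (E₂ : Extension J k₁ k₂) vs →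
           run ρ (E₁ ++ E₂) vs ≡ run ρ E₂ (run ρ E₁ vs)
  run-++ ρ E₁ []       vs = ≡.refl
  run-++ ρ E₁ (E₂ ▷ g) vs = ≡.cong (λ ws → gateValue ρ g ws ∷ ws) (run-++ ρ E₁ E₂ vs)

  lookup-weakenFin : ∀ {J k k′} (ρ : J → Carrier) (E : Extension J k k′) vs i →
                     lookup (run ρ E vs) (weakenFin E i) ≡ lookup vs i
  lookup-weakenFin ρ []      vs i = ≡.refl
  lookup-weakenFin ρ (E ▷ g) vs i = lookup-weakenFin ρ E vs i

  ⟦weaken⟧ : ∀ {J k k′} (ρ : J → Carrier) (E : Extension J k k′) vs o →
             ⟦ weaken E o ⟧ ρ (run ρ E vs) ≡ ⟦ o ⟧ ρ vs
  ⟦weaken⟧ ρ E vs (input i) = ≡.refl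
  ⟦weaken⟧ ρ E vs (gate g)  = lookup-weakenFin ρ E vs g
  ⟦weaken⟧ ρ E vs (const a) = ≡.refl

  runs-toCircuit : ∀ {J k} (ρ : J → Carrier) (E : Extension J 0 k) → Runs ρ (toCircuit E) (run ρ E [])
  runs-toCircuit ρ []                  = Eval.[]
  runs-toCircuit ρ (E ▷ (add , x , y)) = step (plus , x , y) (runs-toCircuit ρ E) _
  runs-toCircuit ρ (E ▷ (mul , x , y)) = step (times , x , y) (runs-toCircuit ρ E) _

  runs-unique : ∀ {J k} (ρ : J → Carrier) (E : Extension J 0 k) {vs} → Runs ρ (toCircuit E) vs → vs ≡ run ρ E []
  runs-unique ρ []                  Eval.[]        = ≡.refl
  runs-unique ρ (E ▷ (add , x , y)) (step _ R _) rewrite runs-unique ρ E R = ≡.refl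
  runs-unique ρ (E ▷ (mul , x , y)) (step _ R _) rewrite runs-unique ρ E R = ≡.refl

  sourceValue : ∀ {I} → (I → Carrier) → Source I → Carrier
  sourceValue vals (var i) = vals i
  sourceValue vals (lit a) = φ a

  Correct : ∀ {I X} → Program I X → ((I → Carrier) → X → Carrier) → Set (lsuc lzero ⊔ c ⊔ ℓ)
  Correct {I} P spec = ∀ {J k} (ρ : J → Carrier) (args : I → Operand F J k) (vs : Vec Carrier k) (vals : I → Carrier) →
    (∀ i → ⟦ args i ⟧ ρ vs ≈ vals i) → ∀ x → ⟦ out (P args) x ⟧ ρ (run ρ (gates (P args)) vs) ≈ spec vals x

  Correct-resp : ∀ {I X} {P : Program I X} {spec spec′ : (I → Carrier) → X → Carrier} →
                 (∀ vals x → spec vals x ≈ spec′ vals x) → Correct P spec → Correct P spec′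
  Correct-resp spec≈spec′ correct ρ args vs vals args≈vals x = trans (correct ρ args vs vals args≈vals x) (spec≈spec′ vals x)

  ⟦source⟧ : ∀ {I J k} (ρ : J → Carrier) (args : I → Operand F J k) vs vals →
             (∀ i → ⟦ args i ⟧ ρ vs ≈ vals i) → ∀ s → ⟦ source args s ⟧ ρ vs ≈ sourceValue vals s
  ⟦source⟧ ρ args vs vals args≈vals (var i) = args≈vals i
  ⟦source⟧ ρ args vs vals args≈vals (lit a) = refl

  relabelIn-correct : ∀ {I I′ X} (h : I → Source I′) {P : Program I X} {spec} → Correct P spec →
                      Correct (relabelIn h P) (λ vals → spec (sourceValue vals ∘ h))
  relabelIn-correct h correct ρ args vs vals args≈vals =
    correct ρ _ vs _ (λ i → ⟦source⟧ ρ args vs vals args≈vals (h i))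

  relabelOut-correct : ∀ {I X Y} (h : Y → X) {P : Program I X} {spec} → Correct P spec →
                       Correct (relabelOut h P) (λ vals → spec vals ∘ h)
  relabelOut-correct h correct ρ args vs vals args≈vals = correct ρ args vs vals args≈vals ∘ h

  seq-correct : ∀ {I X Y} {P : Program I X} {Q : Program (I ⊎ X) Y} {spec₁ spec₂} →
                Correct P spec₁ → Correct Q spec₂ →
                Correct (seq P Q) (λ vals → spec₂ [ vals , spec₁ vals ])
  seq-correct {P = P} {Q} {spec₁} {spec₂} correct₁ correct₂ ρ args vs vals args≈vals = result
    where
    B₁ = P args
    args₂ = [ weaken (gates B₁) ∘ args , out B₁ ]
    B₂ = Q args₂
    vs₁ = run ρ (gates B₁) vs
    args₂≈vals₂ : ∀ i → ⟦ args₂ i ⟧ ρ vs₁ ≈ [ vals , spec₁ vals ] i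
    args₂≈vals₂ (inj₁ i) = trans (reflexive (⟦weaken⟧ ρ (gates B₁) vs (args i))) (args≈vals i)
    args₂≈vals₂ (inj₂ x) = correct₁ ρ args vs vals args≈vals x
    result : ∀ y → ⟦ out B₂ y ⟧ ρ (run ρ (gates B₁ ++ gates B₂) vs) ≈ spec₂ [ vals , spec₁ vals ] y
    result y rewrite run-++ ρ (gates B₁) (gates B₂) vs = correct₂ ρ args₂ vs₁ _ args₂≈vals₂ y

  parallel-correct : ∀ {I X} n {Ps : Fin n → Program I X} {specs : Fin n → (I → Carrier) → X → Carrier} →
                     (∀ a → Correct (Ps a) (specs a)) →
                     Correct (parallel n Ps) (λ vals ax → specs (proj₁ ax) vals (proj₂ ax))
  parallel-correct zero    corrects ρ args vs vals args≈vals (() , _)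
  parallel-correct (suc n) {Ps} {specs} corrects ρ args vs vals args≈vals ax = result ax
    where
    B₀ = Ps Fin.zero args
    args′ = weaken (gates B₀) ∘ args
    Bs = parallel n (Ps ∘ Fin.suc) args′
    vs₀ = run ρ (gates B₀) vs
    result : ∀ ax → ⟦ out (parallel (suc n) Ps args) ax ⟧ ρ (run ρ (gates B₀ ++ gates Bs) vs) ≈
                    specs (proj₁ ax) vals (proj₂ ax)
    result ax rewrite run-++ ρ (gates B₀) (gates Bs) vs with ax
    ... | Fin.zero , x  = trans (reflexive (⟦weaken⟧ ρ (gates Bs) vs₀ (out B₀ x)))
                                (corrects Fin.zero ρ args vs vals args≈vals x)
    ... | Fin.suc a , x = parallel-correct n (corrects ∘ Fin.suc) ρ args′ vs₀ vals
                            (λ i → trans (reflexive (⟦weaken⟧ ρ (gates B₀) vs (args i))) (args≈vals i)) (a , x)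

  mulP-correct : Correct mulP (λ vals _ → vals false * vals true)
  mulP-correct ρ args vs vals args≈vals _ = *-cong (args≈vals false) (args≈vals true)

  sumP-correct : φ (Field.0# F) ≈ 0# → ∀ g → Correct (sumP g) (λ vals _ → sum vals)
  sumP-correct φ0≈0 zero    ρ args vs vals args≈vals _ = φ0≈0
  sumP-correct φ0≈0 (suc g) ρ args vs vals args≈vals _ =
    +-cong (trans (reflexive (⟦weaken⟧ ρ (gates (sumP g (args ∘ Fin.suc))) vs (args Fin.zero))) (args≈vals Fin.zero))
           (sumP-correct φ0≈0 g ρ (args ∘ Fin.suc) vs (vals ∘ Fin.suc) (args≈vals ∘ Fin.suc) tt)

module Padding {c ℓ : Level} (F : Field c ℓ) where
  open Programs F using (Source; var; lit)

  padEntry : ∀ {N d} → MMIn (N ℕ.+ d) → Source (MMIn N)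
  padEntry {N} (x , X , Y) with splitAt N X | splitAt N Y
  ... | inj₁ i | inj₁ j = var (x , i , j)
  ... | _      | _      = lit (Field.0# F)

  padEntry-↑ˡ : ∀ {N d} x (i j : Fin N) → padEntry {N} {d} (x , i ↑ˡ d , j ↑ˡ d) ≡ var (x , i , j)
  padEntry-↑ˡ {N} {d} x i j rewrite Finₚ.splitAt-↑ˡ N i d | Finₚ.splitAt-↑ˡ N j d = ≡.refl

  padEntry-↑ʳ : ∀ {N d} x (i : Fin N) (l : Fin d) → padEntry {N} {d} (x , i ↑ˡ d , N ↑ʳ l) ≡ lit (Field.0# F)
  padEntry-↑ʳ {N} {d} x i l rewrite Finₚ.splitAt-↑ˡ N i d | Finₚ.splitAt-↑ʳ N d l = ≡.refl

  module _ (K : Field c ℓ) (φ : Field.Carrier F → Field.Carrier K)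
           (hom : IsRingHomomorphism (Field.rawRing F) (Field.rawRing K) φ) where
    open Field K
    open Sums K
    open Semantics F K φ using (sourceValue)
    open import Relation.Binary.Reasoning.Setoid setoid

    padded-product : ∀ {N d} vals (ij : Fin N × Fin N) →
      matrixProduct (N ℕ.+ d) (sourceValue vals ∘ padEntry) (proj₁ ij ↑ˡ d , proj₂ ij ↑ˡ d) ≈ matrixProduct N vals ij
    padded-product {N} {d} vals (i , j) = begin
      ∑[ l < N ℕ.+ d ] (A′ (i ↑ˡ d) l * B′ l (j ↑ˡ d))
        ≈⟨ sum-↑ N (λ l → A′ (i ↑ˡ d) l * B′ l (j ↑ˡ d)) ⟩
      ∑[ l < N ] (A′ (i ↑ˡ d) (l ↑ˡ d) * B′ (l ↑ˡ d) (j ↑ˡ d)) +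
      ∑[ l < d ] (A′ (i ↑ˡ d) (N ↑ʳ l) * B′ (N ↑ʳ l) (j ↑ˡ d))
        ≈⟨ +-cong (sum-cong-≋ λ l → reflexive (≡.cong₂ _*_ (≡.cong (sourceValue vals) (padEntry-↑ˡ {d = d} false i l))
                                                          (≡.cong (sourceValue vals) (padEntry-↑ˡ {d = d} true l j))))
                  (sum-zero {f = λ l → A′ (i ↑ˡ d) (N ↑ʳ l) * B′ (N ↑ʳ l) (j ↑ˡ d)}
                            λ l → trans (*-congʳ (padding≈0 l)) (zeroˡ _)) ⟩
      ∑[ l < N ] (vals (false , i , l) * vals (true , l , j)) + 0#
        ≈⟨ +-identityʳ _ ⟩
      ∑[ l < N ] (vals (false , i , l) * vals (true , l , j)) ∎
      where
      A′ B′ : Fin (N ℕ.+ d) → Fin (N ℕ.+ d) → Carrier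
      A′ X Y = sourceValue vals (padEntry (false , X , Y))
      B′ X Y = sourceValue vals (padEntry (true , X , Y))
      padding≈0 : ∀ l → A′ (i ↑ˡ d) (N ↑ʳ l) ≈ 0#
      padding≈0 l = trans (reflexive (≡.cong (sourceValue vals) (padEntry-↑ʳ {d = d} false i l))) (IsRingHomomorphism.0#-homo hom)

module CertifiedPrograms {c ℓ : Level} (F : Field c ℓ) where
  module P = Programs F
  open P using (Program; HasCost; Source; var; lit)
  open import Data.Nat using (_+_; _*_; _≤_)

  IsHom : (K : Field c ℓ) → (Field.Carrier F → Field.Carrier K) → Set (c ⊔ ℓ)
  IsHom K φ = IsRingHomomorphism (Field.rawRing F) (Field.rawRing K) φ

  Spec : Set → Set → Set (lsuc (c ⊔ ℓ))
  Spec I X = (K : Field c ℓ) (φ : Field.Carrier F → Field.Carrier K) → (I → Field.Carrier K) → X → Field.Carrier K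

  record Certified (I X : Set) (s : ℕ) (spec : Spec I X) : Set (lsuc (lsuc lzero ⊔ c ⊔ ℓ)) where
    constructor certified
    field
      program : Program I X
      cost    : HasCost program s
      correct : ∀ K φ → IsHom K φ → Semantics.Correct F K φ program (spec K φ)
  open Certified public

  loosen : ∀ {I X s s′ spec} → s ≤ s′ → Certified I X s spec → Certified I X s′ spec
  loosen s≤s′ C = certified (program C) (λ args → ℕₚ.≤-trans (cost C args) (ℕₚ.+-monoˡ-≤ _ s≤s′)) (correct C)

  respec : ∀ {I X s} {spec spec′ : Spec I X} →
           (∀ K φ → IsHom K φ → ∀ vals x → Field._≈_ K (spec K φ vals x) (spec′ K φ vals x)) →
           Certified I X s spec → Certified I X s spec′
  respec spec≈spec′ C = certified (program C) (cost C)
    (λ K φ hom → Semantics.Correct-resp F K φ {P = program C} (spec≈spec′ K φ hom) (correct C K φ hom))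

  relabelIn : ∀ {I I′ X s spec} (h : I → Source I′) → Certified I X s spec →
              Certified I′ X s (λ K φ vals → spec K φ (Semantics.sourceValue F K φ vals ∘ h))
  relabelIn h C = certified (P.relabelIn h (program C)) (P.relabelIn-cost h {P = program C} (cost C))
    (λ K φ hom → Semantics.relabelIn-correct F K φ h {P = program C} (correct C K φ hom))

  relabelOut : ∀ {I X Y s spec} (h : Y → X) → Certified I X s spec → Certified I Y s (λ K φ vals → spec K φ vals ∘ h)
  relabelOut h C = certified (P.relabelOut h (program C)) (P.relabelOut-cost h {P = program C} (cost C))
    (λ K φ hom → Semantics.relabelOut-correct F K φ h {P = program C} (correct C K φ hom))

  seq : ∀ {I X Y s₁ s₂ spec₁ spec₂} → Certified I X s₁ spec₁ → Certified (I ⊎ X) Y s₂ spec₂ →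
        Certified I Y (s₁ + s₂) (λ K φ vals → spec₂ K φ [ vals , spec₁ K φ vals ])
  seq C D = certified (P.seq (program C) (program D)) (P.seq-cost {P = program C} {program D} (cost C) (cost D))
    (λ K φ hom → Semantics.seq-correct F K φ {P = program C} {program D} (correct C K φ hom) (correct D K φ hom))

  parallel : ∀ {I X s} n {spec : Fin n → Spec I X} → (∀ a → Certified I X s (spec a)) →
             Certified I (Fin n × X) (n * s) (λ K φ vals ax → spec (proj₁ ax) K φ vals (proj₂ ax))
  parallel n Cs = certified (P.parallel n (program ∘ Cs)) (P.parallel-cost n {Ps = program ∘ Cs} (cost ∘ Cs))
    (λ K φ hom → Semantics.parallel-correct F K φ n {Ps = program ∘ Cs} (λ a → correct (Cs a) K φ hom))

  mul : Certified Bool ⊤ 1 (λ K φ vals _ → Field._*_ K (vals false) (vals true))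
  mul = certified P.mulP P.mulP-cost (λ K φ hom → Semantics.mulP-correct F K φ)

  sum : ∀ g → Certified (Fin g) ⊤ g (λ K φ vals _ → Sums.sum K vals)
  sum g = certified (P.sumP g) (P.sumP-cost g)
    (λ K φ hom → Semantics.sumP-correct F K φ (IsRingHomomorphism.0#-homo hom) g)

  mmSpec : ∀ N → Spec (MMIn N) (Fin N × Fin N)
  mmSpec N K φ = Sums.matrixProduct K N

  MMProgram : ℕ → ℕ → Set (lsuc (lsuc lzero ⊔ c ⊔ ℓ))
  MMProgram N s = Certified (MMIn N) (Fin N × Fin N) s (mmSpec N)

  naive : ∀ N → MMProgram N (N * (N * (N * 1 + N)))
  naive N = relabelOut (λ ij → proj₁ ij , proj₂ ij , tt) (parallel N λ i → parallel N λ j →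
    seq (parallel N λ l → relabelIn (λ { false → var (false , i , l) ; true → var (true , l , j) }) mul)
        (relabelIn (λ l → var (inj₂ (l , tt))) (sum N)))

  pad : ∀ {N d s} → MMProgram (N + d) s → MMProgram N s
  pad {N} {d} C = respec (λ K φ hom → Padding.padded-product F K φ hom)
    (relabelOut (λ ij → proj₁ ij ↑ˡ d , proj₂ ij ↑ˡ d) (relabelIn (Padding.padEntry F) C))

  pad≤ : ∀ {N M s} → N ≤ M → MMProgram M s → MMProgram N s
  pad≤ {N} {M} {s} N≤M C = pad {N} {M ∸ N} (≡.subst (λ L → MMProgram L s) (≡.sym (ℕₚ.m+[n∸m]≡n N≤M)) C)
    where open import Data.Nat using (_∸_)

  mmCost≤ : ∀ {N s} → MMProgram N s → MMCost≤ F N s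
  mmCost≤ {N} {s} C =
    end B , ≡.subst (end B ≤_) (ℕₚ.+-identityʳ s) (cost C input) , P.toCircuit (gates B) , (λ i j → out B (i , j)) ,
    (F , id , Identity.isRingHomomorphism (Field.rawRing F) (Field.refl F) , (λ _ → Field.0# F) , _ ,
     Semantics.runs-toCircuit F F id (λ _ → Field.0# F) (gates B)) ,
    computes-product
    where
    open P using (end; gates; out)
    B = program C input
    computes-product : ∀ K φ → IsHom K φ → ∀ ρ vs → Eval.Runs F K φ ρ (P.toCircuit (gates B)) vs → ∀ i j →
      Field._≈_ K (Eval.⟦_⟧ F K φ ρ (out B (i , j)) vs)
                  (sumF K N λ l → Field._*_ K (ρ (false , i , l)) (ρ (true , l , j)))
    computes-product K φ hom ρ vs runs i j rewrite Semantics.runs-unique F K φ ρ (gates B) runs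
                                                 | Sums.sumF≡sum K N (λ l → Field._*_ K (ρ (false , i , l)) (ρ (true , l , j))) =
      correct C K φ hom ρ input [] ρ (λ _ → Field.refl K) (i , j)

module Arithmetic where
  open import Data.Nat using (_+_; _*_; _^_; _≤_; _<_; z≤n; s≤s; ⌈_/2⌉; ⌊_/2⌋)
  open import Data.Nat.Logarithm.Core using (⌈log2⌉-acc-irrelevant)
  open import Data.Nat.Induction using (<-rec)
  open ℕₚ using (≤-refl; ≤-trans; ≤-reflexive; +-mono-≤; *-monoʳ-≤; *-monoˡ-≤; module ≤-Reasoning)

  -- The gate count of RecursiveStep.pipeline: three stages of n²-size
  -- products, g·n² products of size n·t, and the final sums over γ < g.
  stepCost : (n t g s₁ s₂ : ℕ) → ℕ
  stepCost n t g s₁ s₂ = linearForms + (linearForms + (g * ((n * n) * s₁) + (linearForms + (n * (n * t)) * ((n * (n * t)) * g))))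
    where linearForms = g * (t * (t * s₂))

  n≤2^n : ∀ n → n ≤ 2 ^ n
  n≤2^n zero    = z≤n
  n≤2^n (suc n) = +-mono-≤ (ℕₚ.m^n>0 2 n) (≤-trans (n≤2^n n) (ℕₚ.m≤m+n (2 ^ n) 0))

  n≤2⌈n/2⌉ : ∀ n → n ≤ 2 * ⌈ n /2⌉
  n≤2⌈n/2⌉ zero          = z≤n
  n≤2⌈n/2⌉ (suc zero)    = s≤s z≤n
  n≤2⌈n/2⌉ (suc (suc n)) = ≤-trans (s≤s (s≤s (n≤2⌈n/2⌉ n))) (≤-reflexive (≡.sym (ℕₚ.*-suc 2 ⌈ n /2⌉)))

  2⌈n/2⌉≤1+n : ∀ n → 2 * ⌈ n /2⌉ ≤ suc n
  2⌈n/2⌉≤1+n zero          = z≤n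
  2⌈n/2⌉≤1+n (suc zero)    = ≤-refl
  2⌈n/2⌉≤1+n (suc (suc n)) = ≤-trans (≤-reflexive (ℕₚ.*-suc 2 ⌈ n /2⌉)) (s≤s (s≤s (2⌈n/2⌉≤1+n n)))

  ⌈log₂⌉-unfold : ∀ n → ⌈log₂ (2 + n) ⌉ ≡ suc ⌈log₂ (suc ⌈ n /2⌉) ⌉
  ⌈log₂⌉-unfold n = ≡.cong suc (⌈log2⌉-acc-irrelevant (suc ⌈ n /2⌉))

  n≤2^⌈log₂n⌉ : ∀ n → n ≤ 2 ^ ⌈log₂ n ⌉
  n≤2^⌈log₂n⌉ = <-rec _ go
    where
    go : ∀ n → (∀ {m} → m < n → m ≤ 2 ^ ⌈log₂ m ⌉) → n ≤ 2 ^ ⌈log₂ n ⌉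
    go zero          _   = z≤n
    go (suc zero)    _   = ≤-refl
    go (suc (suc n)) rec = begin
      2 + n                              ≤⟨ s≤s (s≤s (n≤2⌈n/2⌉ n)) ⟩
      2 + 2 * ⌈ n /2⌉                    ≡⟨ ℕₚ.*-suc 2 ⌈ n /2⌉ ⟨
      2 * suc ⌈ n /2⌉                    ≤⟨ *-monoʳ-≤ 2 (rec (ℕₚ.⌈n/2⌉<n n)) ⟩
      2 * 2 ^ ⌈log₂ (suc ⌈ n /2⌉) ⌉      ≡⟨ ≡.cong (2 ^_) (⌈log₂⌉-unfold n) ⟨
      2 ^ ⌈log₂ (2 + n) ⌉                ∎
      where open ≤-Reasoning

  2^⌈log₂[2+n]⌉≤2[1+n] : ∀ n → 2 ^ ⌈log₂ (2 + n) ⌉ ≤ 2 * suc n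
  2^⌈log₂[2+n]⌉≤2[1+n] = <-rec _ go
    where
    go : ∀ n → (∀ {m} → m < n → 2 ^ ⌈log₂ (2 + m) ⌉ ≤ 2 * suc m) → 2 ^ ⌈log₂ (2 + n) ⌉ ≤ 2 * suc n
    go zero    _   = ≤-refl
    go (suc n) rec = begin
      2 ^ ⌈log₂ (3 + n) ⌉                 ≡⟨ ≡.cong (2 ^_) (⌈log₂⌉-unfold (suc n)) ⟩
      2 * 2 ^ ⌈log₂ (2 + ⌊ n /2⌋) ⌉       ≤⟨ *-monoʳ-≤ 2 (rec (s≤s (ℕₚ.⌊n/2⌋≤n n))) ⟩
      2 * (2 * ⌈ suc n /2⌉)               ≤⟨ *-monoʳ-≤ 2 (2⌈n/2⌉≤1+n (suc n)) ⟩
      2 * (2 + n)                         ∎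
      where open ≤-Reasoning

  stepCost-≤ : ∀ n t g {s₁ s₂} B → 1 ≤ B → s₁ ≤ (n * t) * (n * t) * B → s₂ ≤ (n * n) * (n * n) * B →
               stepCost n t g s₁ s₂ ≤ (n * (n * t)) * (n * (n * t)) * (5 * g * B)
  stepCost-≤ n t g {s₁} {s₂} B 1≤B s₁≤ s₂≤ = begin
    stepCost n t g s₁ s₂        ≤⟨ +-mono-≤ forms (+-mono-≤ forms (+-mono-≤ products (+-mono-≤ forms assembly))) ⟩
    Y + (Y + (Y + (Y + Y)))    ≡⟨ five-times (n * (n * t)) g B ⟩
    X * (5 * g * B)            ∎
    where
    open ≤-Reasoning
    X Y : ℕ
    X = (n * (n * t)) * (n * (n * t))
    Y = X * (g * B)
    five-times : ∀ x g B → let y = x * x * (g * B) in y + (y + (y + (y + y))) ≡ x * x * (5 * g * B)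
    five-times = solve-∀
    forms-eq : ∀ n t g B → g * (t * (t * ((n * n) * (n * n) * B))) ≡ (n * (n * t)) * (n * (n * t)) * (g * B)
    forms-eq = solve-∀
    products-eq : ∀ n t g B → g * ((n * n) * ((n * t) * (n * t) * B)) ≡ (n * (n * t)) * (n * (n * t)) * (g * B)
    products-eq = solve-∀
    assembly-eq : ∀ x g → x * (x * g) ≡ x * x * (g * 1)
    assembly-eq = solve-∀
    forms : g * (t * (t * s₂)) ≤ Y
    forms = ≤-trans (*-monoʳ-≤ g (*-monoʳ-≤ t (*-monoʳ-≤ t s₂≤))) (≤-reflexive (forms-eq n t g B))
    products : g * ((n * n) * s₁) ≤ Y
    products = ≤-trans (*-monoʳ-≤ g (*-monoʳ-≤ (n * n) s₁≤)) (≤-reflexive (products-eq n t g B))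
    assembly : (n * (n * t)) * ((n * (n * t)) * g) ≤ Y
    assembly = ≤-trans (≤-reflexive (assembly-eq (n * (n * t)) g)) (*-monoʳ-≤ X (*-monoʳ-≤ g 1≤B))

  naive-≤ : ∀ {e k} → e ≤ k → 2 ^ e * (2 ^ e * (2 ^ e * 1 + 2 ^ e)) ≤ 2 ^ e * 2 ^ e * 2 ^ suc k
  naive-≤ {e} e≤k = ≤-trans (≤-reflexive (cubic (2 ^ e))) (*-monoʳ-≤ (2 ^ e * 2 ^ e) (ℕₚ.^-monoʳ-≤ 2 (s≤s e≤k)))
    where
    cubic : ∀ x → x * (x * (x * 1 + x)) ≡ x * x * (2 * x)
    cubic = solve-∀

  -- Writing e = r + 3p with r ≤ 2, the subproblems of exponents 2p + r and 2p
  -- are reachable one level further down.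
  reachable-shrinks : ∀ j E {e p r} → e ≡ r + p * 3 → r ≤ 2 →
    2 ^ suc j * e ≤ 3 ^ suc j * E + 2 ^ suc (suc j) → 2 ^ j * (p + (p + r)) ≤ 3 ^ j * E + 2 ^ suc j
  reachable-shrinks j E {e} {p} {r} e≡ r≤2 reach = ℕₚ.*-cancelˡ-≤ 3 (begin
    3 * (A * (p + (p + r)))              ≡⟨ regroup A p r ⟩
    A * ((2 * (r + p * 3)) + r)          ≤⟨ *-monoʳ-≤ A (ℕₚ.+-monoʳ-≤ (2 * (r + p * 3)) r≤2) ⟩
    A * (2 * (r + p * 3) + 2)            ≡⟨ ≡.cong (λ x → A * (2 * x + 2)) e≡ ⟨
    A * (2 * e + 2)                      ≡⟨ expand A e ⟩
    2 * A * e + 2 * A                    ≤⟨ ℕₚ.+-monoˡ-≤ (2 * A) reach ⟩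
    3 * T * E + 2 * (2 * A) + 2 * A      ≡⟨ collect A T E ⟩
    3 * (T * E + 2 * A)                  ∎)
    where
    open ≤-Reasoning
    A T : ℕ
    A = 2 ^ j
    T = 3 ^ j
    regroup : ∀ A p r → 3 * (A * (p + (p + r))) ≡ A * ((2 * (r + p * 3)) + r)
    regroup = solve-∀
    expand : ∀ A e → A * (2 * e + 2) ≡ 2 * A * e + 2 * A
    expand = solve-∀
    collect : ∀ A T E → 3 * T * E + 2 * (2 * A) + 2 * A ≡ 3 * (T * E + 2 * A)
    collect = solve-∀

  reachable-top : ∀ l {L E} → L ≤ 2 ^ l → 1 ≤ E → 2 ^ (2 * l) * L ≤ 3 ^ (2 * l) * E + 2 ^ suc (2 * l)
  reachable-top l {L} {E} L≤2^l 1≤E = begin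
    2 ^ (2 * l) * L           ≤⟨ *-monoʳ-≤ (2 ^ (2 * l)) L≤2^l ⟩
    2 ^ (2 * l) * 2 ^ l       ≡⟨ ℕₚ.^-distribˡ-+-* 2 (2 * l) l ⟨
    2 ^ (2 * l + l)           ≡⟨ ≡.cong (2 ^_) (three-times l) ⟩
    2 ^ (3 * l)               ≡⟨ ℕₚ.^-*-assoc 2 3 l ⟨
    8 ^ l                     ≤⟨ ℕₚ.^-monoˡ-≤ l (ℕₚ.m≤m+n 8 1) ⟩
    9 ^ l                     ≡⟨ ℕₚ.^-*-assoc 3 2 l ⟩
    3 ^ (2 * l)               ≡⟨ ℕₚ.*-identityʳ _ ⟨
    3 ^ (2 * l) * 1           ≤⟨ *-monoʳ-≤ (3 ^ (2 * l)) 1≤E ⟩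
    3 ^ (2 * l) * E           ≤⟨ ℕₚ.m≤m+n _ _ ⟩
    3 ^ (2 * l) * E + 2 ^ suc (2 * l) ∎
    where
    open ≤-Reasoning
    three-times : ∀ l → 2 * l + l ≡ 3 * l
    three-times = solve-∀

  growth-≤ : ∀ a b l {L p} → L ≤ 2 ^ l → p ≤ L → 5 * (a * p ^ b) ≤ 2 ^ (5 * a + l * b)
  growth-≤ a b l {L} {p} L≤2^l p≤L = begin
    5 * (a * p ^ b)           ≡⟨ ℕₚ.*-assoc 5 a (p ^ b) ⟨
    5 * a * p ^ b             ≤⟨ ℕₚ.*-mono-≤ (n≤2^n (5 * a)) (ℕₚ.^-monoˡ-≤ b (≤-trans p≤L L≤2^l)) ⟩
    2 ^ (5 * a) * (2 ^ l) ^ b ≡⟨ ≡.cong (2 ^ (5 * a) *_) (ℕₚ.^-*-assoc 2 l b) ⟩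
    2 ^ (5 * a) * 2 ^ (l * b) ≡⟨ ℕₚ.^-distribˡ-+-* 2 (5 * a) (l * b) ⟨
    2 ^ (5 * a + l * b)       ∎
    where open ≤-Reasoning

  exponent-≤ : ∀ l c₀ b E → 1 ≤ l → 2 + (2 * l * (c₀ + l * b) + (3 + E)) ≤ (5 + E + 2 * c₀ + 2 * b) * l ^ 2
  exponent-≤ l c₀ b E 1≤l = begin
    2 + (2 * l * (c₀ + l * b) + (3 + E))         ≡⟨ expand l c₀ b E ⟩
    (5 + E) * 1 + 2 * c₀ * l + 2 * b * (l * l)   ≤⟨ ℕₚ.+-monoˡ-≤ (2 * b * (l * l))
                                                     (+-mono-≤ (*-monoʳ-≤ (5 + E) 1≤l²) (*-monoʳ-≤ (2 * c₀) l≤l²)) ⟩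
    (5 + E) * (l * l) + 2 * c₀ * (l * l) + 2 * b * (l * l) ≡⟨ collect l c₀ b E ⟩
    (5 + E + 2 * c₀ + 2 * b) * l ^ 2             ∎
    where
    open ≤-Reasoning
    1≤l² : 1 ≤ l * l
    1≤l² = ℕₚ.*-mono-≤ 1≤l 1≤l
    l≤l² : l ≤ l * l
    l≤l² = ≤-trans (≤-reflexive (≡.sym (ℕₚ.*-identityʳ l))) (*-monoʳ-≤ l 1≤l)
    expand : ∀ l c₀ b E → 2 + (2 * l * (c₀ + l * b) + (3 + E)) ≡ (5 + E) * 1 + 2 * c₀ * l + 2 * b * (l * l)
    expand = solve-∀
    collect : ∀ l c₀ b E → (5 + E) * (l * l) + 2 * c₀ * (l * l) + 2 * b * (l * l) ≡ (5 + E + 2 * c₀ + 2 * b) * (l * (l * 1))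
    collect = solve-∀

  padded-≤ : ∀ {N L} x → 2 ^ L ≤ 2 * N → 2 ^ L * 2 ^ L * 2 ^ x ≤ N ^ 2 * 2 ^ (2 + x)
  padded-≤ {N} {L} x 2^L≤2N = begin
    2 ^ L * 2 ^ L * 2 ^ x         ≤⟨ *-monoˡ-≤ (2 ^ x) (ℕₚ.*-mono-≤ 2^L≤2N 2^L≤2N) ⟩
    2 * N * (2 * N) * 2 ^ x       ≡⟨ regroup N (2 ^ x) ⟩
    N ^ 2 * (2 * (2 * 2 ^ x))     ∎
    where
    open ≤-Reasoning
    regroup : ∀ N y → 2 * N * (2 * N) * y ≡ N * (N * 1) * (2 * (2 * y))
    regroup = solve-∀

  large-exponent : ∀ n₀ {e p r} → e ≡ r + p * 3 → r ≤ 2 → 2 + 3 * suc n₀ < e → n₀ ≤ p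
  large-exponent n₀ {e} {p} {r} e≡ r≤2 large =
    ≤-trans (ℕₚ.n≤1+n n₀) (ℕₚ.<⇒≤ (ℕₚ.*-cancelˡ-< 3 (suc n₀) p (ℕₚ.+-cancelˡ-< 2 _ _ 2+3[1+n₀]<2+3p)))
    where
    open ≤-Reasoning
    2+3[1+n₀]<2+3p : 2 + 3 * suc n₀ < 2 + 3 * p
    2+3[1+n₀]<2+3p = begin-strict
      2 + 3 * suc n₀   <⟨ large ⟩
      e                ≡⟨ e≡ ⟩
      r + p * 3        ≤⟨ ℕₚ.+-monoˡ-≤ (p * 3) r≤2 ⟩
      2 + p * 3        ≡⟨ ≡.cong (2 +_) (ℕₚ.*-comm p 3) ⟩
      2 + 3 * p        ∎

  subproblem-≤ : ∀ {e p r} → e ≡ r + p * 3 → p + (p + r) ≤ e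
  subproblem-≤ {e} {p} {r} e≡ = ≤-trans (ℕₚ.m≤m+n (p + (p + r)) p) (≤-reflexive (≡.sym (≡.trans e≡ (regroup p r))))
    where
    regroup : ∀ p r → r + p * 3 ≡ p + (p + r) + p
    regroup = solve-∀

open Arithmetic using (stepCost)

-- An index X < n·m is combine i x with block i < n and position x < m, and a
-- position x < m is combine x₁ x₂ with x₁ < n and offset x₂ < t.
module RecursiveStep {c ℓ : Level} (F : Field c ℓ) (n t g : ℕ)
                     (u v w : Fin (g ℕ.* (n ℕ.* n)) → Idx F n → Field.Carrier F) where
  open CertifiedPrograms F
  open Programs F using (Source; var; lit)
  open import Data.Nat using (_+_; _*_)

  nn m : ℕ
  nn = n * n
  m  = n * t

  splitₙ : Fin nn → Fin n × Fin n
  splitₙ = remQuot n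
  splitₜ : Fin m → Fin n × Fin t
  splitₜ = remQuot t
  splitₘ : Fin (n * m) → Fin n × Fin m
  splitₘ = remQuot m

  -- (γ , x₂ , y₂ , σ , c): entry (σ , c) of the n² × n² product at block offset (x₂ , y₂).
  Blocks : Set
  Blocks = Fin g × Fin t × Fin t × Fin nn × Fin nn

  blockIndex : Fin g → Fin nn → Fin m → Fin m → Blocks
  blockIndex γ σ x y = γ , proj₂ (splitₜ x) , proj₂ (splitₜ y) , σ , combine (proj₁ (splitₜ x)) (proj₁ (splitₜ y))

  constantTimesSpec : ∀ {I} → (Fin g → Fin nn → Fin nn → Field.Carrier F) →
                      (Fin g → Fin t → Fin t → Fin nn → Fin nn → Source I) → Spec I Blocks
  constantTimesSpec C R K φ vals (γ , x₂ , y₂ , σ , c) =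
    Sums.sum K λ q → Field._*_ K (φ (C γ σ q)) (Semantics.sourceValue F K φ vals (R γ x₂ y₂ q c))

  constantTimes : ∀ {I s₂} → MMProgram nn s₂ → ∀ C (R : Fin g → Fin t → Fin t → Fin nn → Fin nn → Source I) →
                  Certified I Blocks (g * (t * (t * s₂))) (constantTimesSpec C R)
  constantTimes PN C R = parallel g λ γ → parallel t λ x₂ → parallel t λ y₂ → relabelIn (entries γ x₂ y₂) PN
    where
    entries : Fin g → Fin t → Fin t → MMIn nn → Source _
    entries γ x₂ y₂ (false , σ , q) = lit (C γ σ q)
    entries γ x₂ y₂ (true  , q , c) = R γ x₂ y₂ q c

  coefficientMatrix : (Fin (g * nn) → Idx F n → Field.Carrier F) → Fin g → Fin nn → Fin nn → Field.Carrier F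
  coefficientMatrix coef γ σ q = coef (combine γ σ) (splitₙ q)

  blockEntry : ∀ {I} → (MMIn (n * m) → I) → Bool → Fin g → Fin t → Fin t → Fin nn → Fin nn → Source I
  blockEntry ι b γ x₂ y₂ q c = var (ι (b , combine (proj₁ (splitₙ q)) (combine (proj₁ (splitₙ c)) x₂) ,
                                         combine (proj₂ (splitₙ q)) (combine (proj₂ (splitₙ c)) y₂)))

  Products : Set
  Products = Fin g × Fin nn × Fin m × Fin m

  I₀ I₁ I₂ I₃ I₄ : Set
  I₀ = MMIn (n * m)
  I₁ = I₀ ⊎ Blocks
  I₂ = I₁ ⊎ Blocks
  I₃ = I₂ ⊎ Products
  I₄ = I₃ ⊎ Blocks

  factor : Fin g → Fin nn → MMIn m → Source I₂
  factor γ σ (false , x , y) = var (inj₁ (inj₂ (blockIndex γ σ x y)))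
  factor γ σ (true  , y , z) = var (inj₂ (blockIndex γ σ y z))

  productsSpec : Spec I₂ Products
  productsSpec K φ vals (γ , σ , xz) = mmSpec m K φ (Semantics.sourceValue F K φ vals ∘ factor γ σ) xz

  products : ∀ {s₁} → MMProgram m s₁ → Certified I₂ Products (g * (nn * s₁)) productsSpec
  products PM = parallel g λ γ → parallel nn λ σ → relabelIn (factor γ σ) PM

  -- The coefficient of the σ-th product in the output block (i , k) = splitₙ c.
  outputCoefficient : Fin g → Fin nn → Fin nn → Field.Carrier F
  outputCoefficient γ c σ = w (combine γ σ) (proj₂ (splitₙ c) , proj₁ (splitₙ c))

  productEntry : Fin g → Fin t → Fin t → Fin nn → Fin nn → Source I₃
  productEntry γ x₂ z₂ σ c = var (inj₂ (γ , σ , combine (proj₁ (splitₙ c)) x₂ , combine (proj₂ (splitₙ c)) z₂))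

  outputIndex : Fin (n * m) → Fin (n * m) → Fin g → Blocks
  outputIndex X Z γ = blockIndex γ (combine (proj₁ (splitₘ X)) (proj₁ (splitₘ Z))) (proj₂ (splitₘ X)) (proj₂ (splitₘ Z))

  assembleSpec : Spec I₄ (Fin (n * m) × Fin (n * m))
  assembleSpec K φ vals XZ = Sums.sum K λ γ → vals (inj₂ (outputIndex (proj₁ XZ) (proj₂ XZ) γ))

  assemble : Certified I₄ (Fin (n * m) × Fin (n * m)) ((n * m) * ((n * m) * g)) assembleSpec
  assemble = relabelOut (λ XZ → proj₁ XZ , proj₂ XZ , tt) (parallel (n * m) λ X → parallel (n * m) λ Z →
    relabelIn (λ γ → var (inj₂ (outputIndex X Z γ))) (sum g))

  module Stages (K : Field c ℓ) (φ : Field.Carrier F → Field.Carrier K) (vals : I₀ → Field.Carrier K) where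
    vals₁ : I₁ → Field.Carrier K
    vals₁ = [ vals , constantTimesSpec (coefficientMatrix u) (blockEntry id false) K φ vals ]
    vals₂ : I₂ → Field.Carrier K
    vals₂ = [ vals₁ , constantTimesSpec (coefficientMatrix v) (blockEntry inj₁ true) K φ vals₁ ]
    vals₃ : I₃ → Field.Carrier K
    vals₃ = [ vals₂ , productsSpec K φ vals₂ ]
    vals₄ : I₄ → Field.Carrier K
    vals₄ = [ vals₃ , constantTimesSpec outputCoefficient productEntry K φ vals₃ ]

  pipeline : ∀ {s₁ s₂} → MMProgram m s₁ → MMProgram nn s₂ →
             Certified I₀ (Fin (n * m) × Fin (n * m)) (stepCost n t g s₁ s₂)
                       (λ K φ vals → assembleSpec K φ (Stages.vals₄ K φ vals))
  pipeline PM PN = seq (constantTimes PN (coefficientMatrix u) (blockEntry id false))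
                  (seq (constantTimes PN (coefficientMatrix v) (blockEntry inj₁ true))
                  (seq (products PM)
                  (seq (constantTimes PN outputCoefficient productEntry)
                       assemble)))

module RecursiveStepCorrectness {c ℓ : Level} (F : Field c ℓ) (n t g : ℕ)
    (u v w : Fin (g ℕ.* (n ℕ.* n)) → Idx F n → Field.Carrier F)
    (decomposition : ∀ x y z → Field._≈_ F (MMTensor F n x y z)
                                 (sumF F (g ℕ.* (n ℕ.* n)) λ τ → Field._*_ F (u τ x) (Field._*_ F (v τ y) (w τ z))))
    (K : Field c ℓ) (φ : Field.Carrier F → Field.Carrier K)
    (hom : IsRingHomomorphism (Field.rawRing F) (Field.rawRing K) φ)
    (vals : MMIn (n ℕ.* (n ℕ.* t)) → Field.Carrier K) where
  open RecursiveStep F n t g u v w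
  open Stages K φ vals
  open Field K
  open Sums K
  open Bilinear F K φ hom
  open import Relation.Binary.Reasoning.Setoid setoid

  A B : Fin (n ℕ.* m) → Fin (n ℕ.* m) → Carrier
  A X Y = vals (false , X , Y)
  B X Y = vals (true , X , Y)

  Ũ Ṽ : Fin (g ℕ.* nn) → Fin m → Fin m → Carrier
  Ũ τ x y = ∑[ i < n ] ∑[ j < n ] (φ (u τ (i , j)) * A (combine i x) (combine j y))
  Ṽ τ y z = ∑[ j < n ] ∑[ k < n ] (φ (v τ (j , k)) * B (combine j y) (combine k z))

  combine-splitₜ : ∀ x → combine (proj₁ (splitₜ x)) (proj₂ (splitₜ x)) ≡ x
  combine-splitₜ = Finₚ.combine-remQuot {n} t

  linearForm : ∀ {I} coef (ι : I₀ → I) b (vals′ : I → Carrier) γ σ (x₁ : Fin n) (x₂ : Fin t) (y₁ : Fin n) (y₂ : Fin t) →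
    constantTimesSpec (coefficientMatrix coef) (blockEntry ι b) K φ vals′ (γ , x₂ , y₂ , σ , combine x₁ y₁) ≈
    ∑[ i < n ] ∑[ j < n ] (φ (coef (combine γ σ) (i , j)) *
                           vals′ (ι (b , combine i (combine x₁ x₂) , combine j (combine y₁ y₂))))
  linearForm coef ι b vals′ γ σ x₁ x₂ y₁ y₂ = begin
    ∑[ q < nn ] (φ (coef (combine γ σ) (splitₙ q)) * entry (splitₙ q) (splitₙ (combine x₁ y₁)))
      ≡⟨ ≡.cong (λ xy → ∑[ q < nn ] (φ (coef (combine γ σ) (splitₙ q)) * entry (splitₙ q) xy))
                (Finₚ.remQuot-combine x₁ y₁) ⟩
    ∑[ q < nn ] (φ (coef (combine γ σ) (splitₙ q)) * entry (splitₙ q) (x₁ , y₁))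
      ≈⟨ sum-remQuot n (λ ij → φ (coef (combine γ σ) ij) * entry ij (x₁ , y₁)) ⟩
    ∑[ i < n ] ∑[ j < n ] (φ (coef (combine γ σ) (i , j)) * entry (i , j) (x₁ , y₁)) ∎
    where
    entry : Fin n × Fin n → Fin n × Fin n → Carrier
    entry ij xy = vals′ (ι (b , combine (proj₁ ij) (combine (proj₁ xy) x₂) , combine (proj₂ ij) (combine (proj₂ xy) y₂)))

  formsU : ∀ γ σ x y → vals₁ (inj₂ (blockIndex γ σ x y)) ≈ Ũ (combine γ σ) x y
  formsU γ σ x y = trans (linearForm u id false vals γ σ _ _ _ _)
                         (reflexive (≡.cong₂ (Ũ (combine γ σ)) (combine-splitₜ x) (combine-splitₜ y)))

  formsV : ∀ γ σ y z → vals₂ (inj₂ (blockIndex γ σ y z)) ≈ Ṽ (combine γ σ) y z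
  formsV γ σ y z = trans (linearForm v inj₁ true vals₁ γ σ _ _ _ _)
                         (reflexive (≡.cong₂ (Ṽ (combine γ σ)) (combine-splitₜ y) (combine-splitₜ z)))

  products-correct : ∀ γ σ x z →
                     vals₃ (inj₂ (γ , σ , x , z)) ≈ ∑[ y < m ] (Ũ (combine γ σ) x y * Ṽ (combine γ σ) y z)
  products-correct γ σ x z = sum-cong-≋ λ y → *-cong (formsU γ σ x y) (formsV γ σ y z)

  combinations : ∀ γ i k x z → vals₄ (inj₂ (blockIndex γ (combine i k) x z)) ≈
                 ∑[ σ < nn ] (φ (w (combine γ σ) (k , i)) * ∑[ y < m ] (Ũ (combine γ σ) x y * Ṽ (combine γ σ) y z))
  combinations γ i k x z = begin
    H (splitₙ (combine i k)) (splitₙ (combine x₁ z₁))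
      ≡⟨ ≡.cong₂ H (Finₚ.remQuot-combine i k) (Finₚ.remQuot-combine x₁ z₁) ⟩
    H (i , k) (x₁ , z₁)
      ≡⟨ ≡.cong₂ (λ x′ z′ → ∑[ σ < nn ] (φ (w (combine γ σ) (k , i)) * vals₃ (inj₂ (γ , σ , x′ , z′))))
                 (combine-splitₜ x) (combine-splitₜ z) ⟩
    ∑[ σ < nn ] (φ (w (combine γ σ) (k , i)) * vals₃ (inj₂ (γ , σ , x , z)))
      ≈⟨ sum-cong-≋ (λ σ → *-congˡ (products-correct γ σ x z)) ⟩
    ∑[ σ < nn ] (φ (w (combine γ σ) (k , i)) * ∑[ y < m ] (Ũ (combine γ σ) x y * Ṽ (combine γ σ) y z)) ∎
    where
    x₁ = proj₁ (splitₜ x)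
    x₂ = proj₂ (splitₜ x)
    z₁ = proj₁ (splitₜ z)
    z₂ = proj₂ (splitₜ z)
    H : Fin n × Fin n → Fin n × Fin n → Carrier
    H ik xz = ∑[ σ < nn ] (φ (w (combine γ σ) (proj₂ ik , proj₁ ik)) *
                           vals₃ (inj₂ (γ , σ , combine (proj₁ xz) x₂ , combine (proj₂ xz) z₂)))

  computes-product : ∀ XZ → assembleSpec K φ vals₄ XZ ≈ matrixProduct (n ℕ.* m) vals XZ
  computes-product (X , Z) = begin
    ∑[ γ < g ] vals₄ (inj₂ (outputIndex X Z γ))
      ≈⟨ sum-cong-≋ (λ γ → combinations γ i₀ k₀ x z) ⟩
    ∑[ γ < g ] ∑[ σ < nn ] G (combine γ σ)
      ≈⟨ sym (sum-combine g G) ⟩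
    ∑[ τ < g ℕ.* nn ] G τ
      ≈⟨ block-bilinear-algorithm i₀ k₀
           (λ τ i j → φ (u τ (i , j))) (λ τ j k → φ (v τ (j , k))) (λ τ → φ (w τ (k₀ , i₀)))
           (image-of-decomposition u v w decomposition i₀ k₀)
           (λ i j y → A (combine i x) (combine j y)) (λ j k y → B (combine j y) (combine k z)) ⟩
    ∑[ y < m ] ∑[ j < n ] (A (combine i₀ x) (combine j y) * B (combine j y) (combine k₀ z))
      ≈⟨ ∑-comm {m} {n} (λ y j → A (combine i₀ x) (combine j y) * B (combine j y) (combine k₀ z)) ⟩
    ∑[ j < n ] ∑[ y < m ] (A (combine i₀ x) (combine j y) * B (combine j y) (combine k₀ z))
      ≈⟨ sym (sum-combine n (λ Y → A (combine i₀ x) Y * B Y (combine k₀ z))) ⟩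
    ∑[ Y < n ℕ.* m ] (A (combine i₀ x) Y * B Y (combine k₀ z))
      ≡⟨ ≡.cong₂ (λ X′ Z′ → ∑[ Y < n ℕ.* m ] (A X′ Y * B Y Z′))
                 (Finₚ.combine-remQuot {n} m X) (Finₚ.combine-remQuot {n} m Z) ⟩
    ∑[ Y < n ℕ.* m ] (A X Y * B Y Z) ∎
    where
    i₀ = proj₁ (splitₘ X)
    x  = proj₂ (splitₘ X)
    k₀ = proj₁ (splitₘ Z)
    z  = proj₂ (splitₘ Z)
    G : Fin (g ℕ.* nn) → Carrier
    G τ = φ (w τ (k₀ , i₀)) * ∑[ y < m ] (Ũ τ x y * Ṽ τ y z)

module _ {c ℓ : Level} (F : Field c ℓ) where
  open CertifiedPrograms F

  rankStep : ∀ {n t g s₁ s₂} → RankAtMost F n (g ℕ.* (n ℕ.* n)) →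
             MMProgram (n ℕ.* t) s₁ → MMProgram (n ℕ.* n) s₂ → MMProgram (n ℕ.* (n ℕ.* t)) (stepCost n t g s₁ s₂)
  rankStep {n} {t} {g} (u , v , w , decomposition) PM PN =
    respec (λ K φ hom vals → RecursiveStepCorrectness.computes-product F n t g u v w decomposition K φ hom vals)
           (RecursiveStep.pipeline F n t g u v w PM PN)

module Recursion {c ℓ : Level} (F : Field c ℓ) (a b n₀ : ℕ)
    (rank : (n : ℕ) → n ℕ.≥ n₀ → RankAtMost F n (a ℕ.* (n ℕ.^ 2) ℕ.* (⌈log₂ n ⌉ ℕ.^ b))) where
  open CertifiedPrograms F
  open Arithmetic
  open import Data.Nat using (_+_; _*_; _^_; _≤_; _≤?_; z≤n; s≤s)
  open import Data.Nat.DivMod using (_/_; _%_; m≡m%n+[m/n]*n; m%n<n)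
  open import Relation.Nullary using (yes; no)
  open ℕₚ using (≤-refl; ≤-trans; ≤-reflexive; *-monoʳ-≤; *-monoˡ-≤)

  -- Exponents up to 2 + E are handled by the naive algorithm; beyond that the
  -- rank hypothesis applies to the block size 2 ^ (e / 3).
  E : ℕ
  E = 3 * suc n₀

  rank-at-power : ∀ p → n₀ ≤ p → RankAtMost F (2 ^ p) ((a * p ^ b) * (2 ^ p * 2 ^ p))
  rank-at-power p n₀≤p = ≡.subst (RankAtMost F (2 ^ p)) size (rank (2 ^ p) (≤-trans n₀≤p (n≤2^n p)))
    where
    regroup : ∀ a n q → a * (n * (n * 1)) * q ≡ (a * q) * (n * n)
    regroup = solve-∀
    size : a * (2 ^ p) ^ 2 * ⌈log₂ (2 ^ p) ⌉ ^ b ≡ (a * p ^ b) * (2 ^ p * 2 ^ p)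
    size = ≡.trans (≡.cong (λ x → a * (2 ^ p) ^ 2 * x ^ b) (⌈log₂2^n⌉≡n p)) (regroup a (2 ^ p) (p ^ b))

  -- δ bounds the logarithm of the per-level growth 5·g of the overhead, for
  -- all exponents up to M.
  module Levels (M δ : ℕ) (growth : ∀ p → p ≤ M → 5 * (a * p ^ b) ≤ 2 ^ δ) where
    overhead : ℕ → ℕ
    overhead j = 2 ^ (j * δ + (3 + E))

    Target : ℕ → ℕ → Set (lsuc (lsuc lzero ⊔ c ⊔ ℓ))
    Target j e = MMProgram (2 ^ e) (2 ^ e * 2 ^ e * overhead j)

    overhead-suc : ∀ j → 2 ^ δ * overhead j ≡ overhead (suc j)
    overhead-suc j = ≡.trans (≡.sym (ℕₚ.^-distribˡ-+-* 2 δ (j * δ + (3 + E))))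
                             (≡.cong (2 ^_) (≡.sym (ℕₚ.+-assoc δ (j * δ) (3 + E))))

    base : ∀ j {e} → e ≤ 2 + E → Target j e
    base j {e} e≤ = loosen naive-cost (naive (2 ^ e))
      where
      naive-cost : 2 ^ e * (2 ^ e * (2 ^ e * 1 + 2 ^ e)) ≤ 2 ^ e * 2 ^ e * overhead j
      naive-cost = ≤-trans (naive-≤ e≤) (*-monoʳ-≤ (2 ^ e * 2 ^ e) (ℕₚ.^-monoʳ-≤ 2 (ℕₚ.m≤n+m (3 + E) (j * δ))))

    resize : ∀ {j N N′} → N ≡ N′ → MMProgram N (N * N * overhead j) → MMProgram N′ (N′ * N′ * overhead j)
    resize {j} = ≡.subst (λ N → MMProgram N (N * N * overhead j))

    step : ∀ j {p r} → n₀ ≤ p → p ≤ M → Target j (p + (p + r)) → Target j (p + p) → Target (suc j) (r + p * 3)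
    step j {p} {r} n₀≤p p≤M larger smaller =
      resize {suc j} size (loosen cost-≤ (rankStep F {n} {t} {a * p ^ b} {s₁} {s₂} (rank-at-power p n₀≤p)
                                                 (resize {j} (ℕₚ.^-distribˡ-+-* 2 p (p + r)) larger)
                                                 (resize {j} (ℕₚ.^-distribˡ-+-* 2 p p) smaller)))
      where
      n t X s₁ s₂ : ℕ
      n = 2 ^ p
      t = 2 ^ (p + r)
      X = n * (n * t)
      s₁ = n * t * (n * t) * overhead j
      s₂ = n * n * (n * n) * overhead j
      cost-≤ : stepCost n t (a * p ^ b) s₁ s₂ ≤ X * X * overhead (suc j)
      cost-≤ = ≤-trans (stepCost-≤ n t (a * p ^ b) (overhead j) (ℕₚ.m^n>0 2 (j * δ + (3 + E))) ≤-refl ≤-refl)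
                     (*-monoʳ-≤ (X * X) (≤-trans (*-monoˡ-≤ (overhead j) (growth p p≤M)) (≤-reflexive (overhead-suc j))))
      regroup : ∀ p r → p + (p + (p + r)) ≡ r + p * 3
      regroup = solve-∀
      size : X ≡ 2 ^ (r + p * 3)
      size = begin-equality
        n * (n * t)              ≡⟨ ≡.cong (n *_) (ℕₚ.^-distribˡ-+-* 2 p (p + r)) ⟨
        n * 2 ^ (p + (p + r))    ≡⟨ ℕₚ.^-distribˡ-+-* 2 p (p + (p + r)) ⟨
        2 ^ (p + (p + (p + r)))  ≡⟨ ≡.cong (2 ^_) (regroup p r) ⟩
        2 ^ (r + p * 3)          ∎
        where open ℕₚ.≤-Reasoning

    -- The invariant 2 ^ j · e ≤ 3 ^ j · E + 2 ^ (j + 1) lets the exponent grow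
    -- by a factor 3/2 per level while the recursion stays within depth j.
    build : ∀ j {e} → e ≤ M → 2 ^ j * e ≤ 3 ^ j * E + 2 ^ suc j → Target j e
    build zero {e} e≤M reach =
      base zero (≡.subst₂ _≤_ (ℕₚ.+-identityʳ e) (≡.trans (≡.cong (_+ 2) (ℕₚ.+-identityʳ E)) (ℕₚ.+-comm E 2))
                              reach)
    build (suc j) {e} e≤M reach with e ≤? 2 + E
    ... | yes small = base (suc j) small
    ... | no large  = ≡.subst (Target (suc j)) (≡.sym e≡)
                        (step j {p} {r} (large-exponent n₀ {e} {p} {r} e≡ r≤2 (ℕₚ.≰⇒> large)) (≤-trans p≤e e≤M)
                              (build j {p + (p + r)} (≤-trans q≤e e≤M) reach′)
                              (build j {p + p} (≤-trans (≤-trans 2p≤q q≤e) e≤M)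
                                     (≤-trans (*-monoʳ-≤ (2 ^ j) 2p≤q) reach′)))
      where
      p r : ℕ
      p = e / 3
      r = e % 3
      e≡ : e ≡ r + p * 3
      e≡ = m≡m%n+[m/n]*n e 3
      r≤2 : r ≤ 2
      r≤2 = ℕₚ.≤-pred (m%n<n e 3)
      reach′ : 2 ^ j * (p + (p + r)) ≤ 3 ^ j * E + 2 ^ suc j
      reach′ = reachable-shrinks j E {e} {p} {r} e≡ r≤2 reach
      q≤e : p + (p + r) ≤ e
      q≤e = subproblem-≤ {e} {p} {r} e≡
      2p≤q : p + p ≤ p + (p + r)
      2p≤q = ℕₚ.+-monoʳ-≤ p (ℕₚ.m≤m+n p r)
      p≤e : p ≤ e
      p≤e = ≤-trans (ℕₚ.m≤m+n p (p + r)) q≤e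

  C : ℕ
  C = 5 + E + 2 * (5 * a) + 2 * b

  -- Pad N up to 2 ^ L with L = ⌈log₂ N⌉ and recurse to depth 2 ⌈log₂ L⌉, so
  -- that the overhead is 2 ^ O(⌈log₂ L⌉²).
  fastMM : ∀ N → 3 ≤ N → MMProgram N (N ^ 2 * 2 ^ (C * ⌈log₂ ⌈log₂ N ⌉ ⌉ ^ 2))
  fastMM zero             ()
  fastMM (suc zero)       (s≤s ())
  fastMM N@(suc (suc k)) 3≤N =
    loosen cost-≤ (pad≤ (n≤2^⌈log₂n⌉ N) (build (2 * l) ≤-refl (reachable-top l (n≤2^⌈log₂n⌉ L) (s≤s z≤n))))
    where
    L l : ℕ
    L = ⌈log₂ N ⌉
    l = ⌈log₂ L ⌉
    open Levels L (5 * a + l * b) (λ p p≤L → growth-≤ a b l (n≤2^⌈log₂n⌉ L) p≤L)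
    1≤l : 1 ≤ l
    1≤l = ⌈log₂⌉-mono-≤ (⌈log₂⌉-mono-≤ {3} 3≤N)
    2^L≤2N : 2 ^ L ≤ 2 * N
    2^L≤2N = ≤-trans (2^⌈log₂[2+n]⌉≤2[1+n] k) (*-monoʳ-≤ 2 (ℕₚ.n≤1+n (suc k)))
    cost-≤ : 2 ^ L * 2 ^ L * overhead (2 * l) ≤ N ^ 2 * 2 ^ (C * l ^ 2)
    cost-≤ = ≤-trans (padded-≤ {N} {L} (2 * l * (5 * a + l * b) + (3 + E)) 2^L≤2N)
                   (*-monoʳ-≤ (N ^ 2) (ℕₚ.^-monoʳ-≤ 2 (exponent-≤ l (5 * a) b E 1≤l)))

open import Data.Nat using (_*_; _^_; _≥_)

corollary2p6 : {c ℓ : Level} (F : Field c ℓ) →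
    (Σ ℕ λ a → Σ ℕ λ b → Σ ℕ λ n₀ →
       (n : ℕ) → n ≥ n₀ → RankAtMost F n (a * (n ^ 2) * (⌈log₂ n ⌉ ^ b))) →
    Σ ℕ λ C → Σ ℕ λ N₀ →
      (N : ℕ) → N ≥ N₀ →
      MMCost≤ F N ((N ^ 2) * (2 ^ (C * (⌈log₂ ⌈log₂ N ⌉ ⌉ ^ 2))))
corollary2p6 F (a , b , n₀ , rank) = C , 3 , λ N 3≤N → CertifiedPrograms.mmCost≤ F (fastMM N 3≤N)
  where open Recursion F a b n₀ rank
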